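{- If a correspondence formula $\varphi(x)$ (free variables among $\{x\}$) is logically equivalent to $ST_{22}(I,x)$ for some modal intuitionistic formula $I$, then $\varphi(x)$ is invariant with respect to $(2,2)$-modal asimulations.
   Context: Correspondence language: classical first-order logic without identity over $\Sigma=\{R,R_\Box,R_\Diamond,P_1,P_2,\dots\}$, $R,R_\Box,R_\Diamond$ binary, $P_n$ unary. For $\Theta\subseteq\Sigma$ containing $R,R_\Box,R_\Diamond$, a $\Theta$-model $M_\mu=\langle U_\mu,\iota_\mu\rangle$ is a classical structure for $\Theta$; write $R_\mu,R_{\Box\mu},R_{\Diamond\mu}$ for the interpretations. $\Sigma_\varphi=\{R,R_\Box,R_\Diamond\}\cup\{P_n:P_n\text{ occurs in }\varphi\}$. Modal intuitionistic formulas are built from letters $p_n$ and $\bot$ by $\wedge,\vee,\to,\Box,\Diamond$. $ST_{22}(p_n,x)=P_n(x)$, $ST_{22}(\bot,x)=\bot$, $\wedge,\vee$ componentwise, $ST_{22}(I\to J,x)=\forall y(R(x,y)\to(ST_{22}(I,y)\to ST_{22}(J,y)))$, $ST_{22}(\Box I,x)=\forall y(R(x,y)\to\forall z(R_\Box(y,z)\to ST_{22}(I,z)))$, $ST_{22}(\Diamond I,x)=\forall y(R(x,y)\to\exists z(R_\Diamond(y,z)\wedge ST_{22}(I,z)))$. A $(2,2)$-modal $\langle(M_1,t),(M_2,u)\rangle$-asimulation between pointed $\Theta$-models is a pair $(A,B)$ of binary relations such that for all $\mu,\nu\in\{1,2\}$, $a,c,e\in U_\mu$, $b,d,f\in U_\nu$,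 unary $P\in\Theta$: $A,B\subseteq(U_1\times U_2)\cup(U_2\times U_1)$; $tAu$; if $aAb$ and $M_\mu,a\models P(x)$ then $M_\nu,b\models P(x)$; if $aAb$ and $bR_\nu d$ then some $c\in U_\mu$ has $aR_\mu c$, $cAd$, $dAc$; if $aAb$, $bR_\nu d$, $dR_{\Box\nu}f$ then some $c,e\in U_\mu$ have $aR_\mu c$, $cR_{\Box\mu}e$, $eAf$; if $aAb$ and $bR_\nu d$ then some $c\in U_\mu$ has $aR_\mu c$ and $cBd$; if $aBb$ and $aR_{\Diamond\mu}c$ then some $d\in U_\nu$ has $bR_{\Diamond\nu}d$ and $cAd$. $\varphi(x)$ is invariant with respect to $(2,2)$-modal asimulations iff for every $\Theta\supseteq\Sigma_\varphi$, all $\Theta$-models $M_1,M_2$, $t\in U_1,u\in U_2$, every such $(A,B)$, and all $a\in U_1,b\in U_2$: $aAb$ and $M_1,a\models\varphi(x)$ imply $M_2,b\models\varphi(x)$. -}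

module Defs where

open import Data.Nat using (ℕ; suc; _+_)
open import Data.Nat using (_≡ᵇ_)
open import Data.Bool using (if_then_else_)
open import Data.Product using (Σ; _×_; _,_; ∃)
open import Data.Sum using (_⊎_)
open import Data.Empty using (⊥)
open import Relation.Binary.PropositionalEquality using (_≡_)
open import Relation.Nullary using (¬_)
open import Function.Bundles using (_⇔_)

Var : Set
Var = ℕ

data Fm : Set where
  atR  : Var → Var → Fm
  atR□ : Var → Var → Fm
  atR◇ : Var → Var → Fm
  atP  : ℕ → Var → Fm
  ⊥F   : Fm
  _∧F_ : Fm → Fm → Fm
  _∨F_ : Fm → Fm → Fm
  _⇒F_ : Fm → Fm → Fm
  ∀F   : Var → Fm → Fm
  ∃F   : Var → Fm → Fm

data OccursP (n : ℕ) : Fm → Set where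
  here  : ∀ {v} → OccursP n (atP n v)
  ∧ˡ : ∀ {φ ψ} → OccursP n φ → OccursP n (φ ∧F ψ)
  ∧ʳ : ∀ {φ ψ} → OccursP n ψ → OccursP n (φ ∧F ψ)
  ∨ˡ : ∀ {φ ψ} → OccursP n φ → OccursP n (φ ∨F ψ)
  ∨ʳ : ∀ {φ ψ} → OccursP n ψ → OccursP n (φ ∨F ψ)
  ⇒ˡ : ∀ {φ ψ} → OccursP n φ → OccursP n (φ ⇒F ψ)
  ⇒ʳ : ∀ {φ ψ} → OccursP n ψ → OccursP n (φ ⇒F ψ)
  ∀o : ∀ {v φ} → OccursP n φ → OccursP n (∀F v φ)
  ∃o : ∀ {v φ} → OccursP n φ → OccursP n (∃F v φ)

data Free (x : Var) : Fm → Set where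
  R₁  : ∀ {y} → Free x (atR x y)
  R₂  : ∀ {y} → Free x (atR y x)
  R□₁ : ∀ {y} → Free x (atR□ x y)
  R□₂ : ∀ {y} → Free x (atR□ y x)
  R◇₁ : ∀ {y} → Free x (atR◇ x y)
  R◇₂ : ∀ {y} → Free x (atR◇ y x)
  Pf  : ∀ {n} → Free x (atP n x)
  ∧ˡ : ∀ {φ ψ} → Free x φ → Free x (φ ∧F ψ)
  ∧ʳ : ∀ {φ ψ} → Free x ψ → Free x (φ ∧F ψ)
  ∨ˡ : ∀ {φ ψ} → Free x φ → Free x (φ ∨F ψ)
  ∨ʳ : ∀ {φ ψ} → Free x ψ → Free x (φ ∨F ψ)
  ⇒ˡ : ∀ {φ ψ} → Free x φ → Free x (φ ⇒F ψ)
  ⇒ʳ : ∀ {φ ψ} → Free x ψ → Free x (φ ⇒F ψ)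
  ∀f : ∀ {v φ} → ¬ (x ≡ v) → Free x φ → Free x (∀F v φ)
  ∃f : ∀ {v φ} → ¬ (x ≡ v) → Free x φ → Free x (∃F v φ)

-- Structures.  A structure interprets R, R□, R◇ and every P_n
-- (interpretations of letters outside Θ are irrelevant).

record Model : Set₁ where
  field
    U   : Set
    Rm  : U → U → Set
    R□m : U → U → Set
    R◇m : U → U → Set
    Pm  : ℕ → U → Set
open Model public

_[_↦_] : {A : Set} → (Var → A) → Var → A → (Var → A)
(ρ [ v ↦ a ]) w = if w ≡ᵇ v then a else ρ w

Sat : (M : Model) → (Var → U M) → Fm → Set
Sat M ρ (atR x y)  = Rm M (ρ x) (ρ y)
Sat M ρ (atR□ x y) = R□m M (ρ x) (ρ y)
Sat M ρ (atR◇ x y) = R◇m M (ρ x) (ρ y)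
Sat M ρ (atP n x)  = Pm M n (ρ x)
Sat M ρ ⊥F         = ⊥
Sat M ρ (φ ∧F ψ)   = Sat M ρ φ × Sat M ρ ψ
Sat M ρ (φ ∨F ψ)   = Sat M ρ φ ⊎ Sat M ρ ψ
Sat M ρ (φ ⇒F ψ)   = Sat M ρ φ → Sat M ρ ψ
Sat M ρ (∀F v φ)   = (a : U M) → Sat M (ρ [ v ↦ a ]) φ
Sat M ρ (∃F v φ)   = Σ (U M) λ a → Sat M (ρ [ v ↦ a ]) φ

-- The formula has free variables among {x} (x = variable 0).
OnlyFreeX : Fm → Set
OnlyFreeX φ = ∀ v → Free v φ → v ≡ 0

_,_⊨x_ : (M : Model) → U M → Fm → Set
M , a ⊨x φ = Sat M (λ _ → a) φ

LogEquiv : Fm → Fm → Set₁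
LogEquiv φ ψ = (M : Model) (ρ : Var → U M) → Sat M ρ φ ⇔ Sat M ρ ψ

data MFm : Set where
  var  : ℕ → MFm
  ⊥M   : MFm
  _∧M_ : MFm → MFm → MFm
  _∨M_ : MFm → MFm → MFm
  _⇒M_ : MFm → MFm → MFm
  □M   : MFm → MFm
  ◇M   : MFm → MFm

-- Bound variables y, z are chosen as x+1, x+2 (fresh w.r.t. the
-- only free variable x of the translated subformula).
ST22 : MFm → Var → Fm
ST22 (var n)   x = atP n x
ST22 ⊥M        x = ⊥F
ST22 (I ∧M J)  x = ST22 I x ∧F ST22 J x
ST22 (I ∨M J)  x = ST22 I x ∨F ST22 J x
ST22 (I ⇒M J)  x = ∀F (suc x) (atR x (suc x) ⇒F (ST22 I (suc x) ⇒F ST22 J (suc x)))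
ST22 (□M I)    x = ∀F (suc x) (atR x (suc x) ⇒F
                      ∀F (suc (suc x)) (atR□ (suc x) (suc (suc x)) ⇒F ST22 I (suc (suc x))))
ST22 (◇M I)    x = ∀F (suc x) (atR x (suc x) ⇒F
                      ∃F (suc (suc x)) (atR◇ (suc x) (suc (suc x)) ∧F ST22 I (suc (suc x))))

-- (2,2)-modal asimulations.  A ⊆ (U₁×U₂) ∪ (U₂×U₁) is represented by the
-- two components A₁₂ ⊆ U₁×U₂ and A₂₁ ⊆ U₂×U₁ (likewise B).
-- The clauses for a fixed direction (μ,ν) = (M,N):

record AsimClauses (Θ : ℕ → Set) (M N : Model)
    (AMN : U M → U N → Set) (ANM : U N → U M → Set)
    (BMN : U M → U N → Set) : Set where
  field
    atoms : ∀ n → Θ n → ∀ a b → AMN a b → Pm M n a → Pm N n b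
    forth : ∀ a b d → AMN a b → Rm N b d →
              Σ (U M) λ c → Rm M a c × AMN c d × ANM d c
    box   : ∀ a b d f → AMN a b → Rm N b d → R□m N d f →
              Σ (U M) λ c → Σ (U M) λ e → Rm M a c × R□m M c e × AMN e f
    toB   : ∀ a b d → AMN a b → Rm N b d →
              Σ (U M) λ c → Rm M a c × BMN c d
    dia   : ∀ a b c → BMN a b → R◇m M a c →
              Σ (U N) λ d → R◇m N b d × AMN c d

record Asim22 (Θ : ℕ → Set) (M₁ M₂ : Model) (t : U M₁) (u : U M₂)
    (A₁₂ : U M₁ → U M₂ → Set) (A₂₁ : U M₂ → U M₁ → Set)
    (B₁₂ : U M₁ → U M₂ → Set) (B₂₁ : U M₂ → U M₁ → Set) : Set where
  field
    root : A₁₂ t u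
    dir₁₂ : AsimClauses Θ M₁ M₂ A₁₂ A₂₁ B₁₂
    dir₂₁ : AsimClauses Θ M₂ M₁ A₂₁ A₁₂ B₂₁

-- Θ ⊇ Σ_φ  (R, R□, R◇ are always present).
ContainsSig : (ℕ → Set) → Fm → Set
ContainsSig Θ φ = ∀ n → OccursP n φ → Θ n

Invariant22 : Fm → Set₁
Invariant22 φ =
  (Θ : ℕ → Set) → ContainsSig Θ φ →
  (M₁ M₂ : Model) (t : U M₁) (u : U M₂)
  (A₁₂ : U M₁ → U M₂ → Set) (A₂₁ : U M₂ → U M₁ → Set)
  (B₁₂ : U M₁ → U M₂ → Set) (B₂₁ : U M₂ → U M₁ → Set) →
  Asim22 Θ M₁ M₂ t u A₁₂ A₂₁ B₁₂ B₂₁ →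
  (a : U M₁) (b : U M₂) → A₁₂ a b → M₁ , a ⊨x φ → M₂ , b ⊨x φ

module Submission where

-- Give modal intuitionistic formulas their Kripke forcing
-- relation  M , a ⊩ I  and show that the standard translation is correct:
-- ST22 I x holds under ρ iff ρ x forces I.  Next, observe that (2,2)-modal
-- asimulations preserve forcing of every formula I, by induction on I, as
-- long as the atom clause is available for every letter of I.  The letters
-- of I need not lie in Θ ⊇ Σ_φ, since φ is only logically equivalent to
-- ST22 I 0; this is repaired by restricting both models to Θ (every letter
-- outside Θ becomes empty).  The restriction does not change the truth of φ,
-- and it turns a Θ-asimulation into an asimulation for the full signature.
-- Hence  M , a ⊨x φ  iff  a forces I in the Θ-restriction of M, and the
-- theorem follows by transporting forcing of I along the asimulation.

open import Defs
open import Data.Nat using (ℕ; suc; _≡ᵇ_)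
open import Data.Nat.Properties using (≡ᵇ⇒≡; ≡⇒≡ᵇ; 1+n≢n)
open import Data.Bool using (true; false)
open import Data.Product using (Σ; _×_; _,_; proj₂)
open import Data.Product.Function.NonDependent.Propositional using (_×-⇔_)
open import Data.Sum using (_⊎_; inj₁; inj₂)
open import Data.Sum.Function.Propositional using (_⊎-⇔_)
open import Data.Empty using (⊥; ⊥-elim)
open import Data.Unit using (⊤)
open import Function using (_∘_)
open import Function.Bundles using (_⇔_; mk⇔; Equivalence)
open import Function.Construct.Identity using (⇔-id)
open import Function.Construct.Composition using (_⇔-∘_)
open import Function.Related.TypeIsomorphisms using (→-cong-⇔)
open import Relation.Binary.PropositionalEquality using (_≡_; _≢_; refl; sym; trans)

open Equivalence using (to; from)

∀-⇔ : {A : Set} {P Q : A → Set} → (∀ a → P a ⇔ Q a) → ((a : A) → P a) ⇔ ((a : A) → Q a)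
∀-⇔ P⇔Q = mk⇔ (λ f a → to (P⇔Q a) (f a)) (λ g a → from (P⇔Q a) (g a))

∃-⇔ : {A : Set} {P Q : A → Set} → (∀ a → P a ⇔ Q a) → Σ A P ⇔ Σ A Q
∃-⇔ P⇔Q = mk⇔ (λ (a , p) → a , to (P⇔Q a) p) (λ (a , q) → a , from (P⇔Q a) q)

respects₂ : {A : Set} (R : A → A → Set) {a a′ b b′ : A} →
            a ≡ a′ → b ≡ b′ → R a b ⇔ R a′ b′
respects₂ R refl refl = ⇔-id _

update-same : {A : Set} (ρ : Var → A) (v : Var) (a : A) → (ρ [ v ↦ a ]) v ≡ a
update-same ρ v a with v ≡ᵇ v | ≡⇒≡ᵇ v v refl
... | true | _ = refl

update-other : {A : Set} (ρ : Var → A) {v w : Var} (a : A) → w ≢ v → (ρ [ v ↦ a ]) w ≡ ρ w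
update-other ρ {v} {w} a w≢v with w ≡ᵇ v | ≡ᵇ⇒≡ w v
... | false | _   = refl
... | true  | w≡v = ⊥-elim (w≢v (w≡v _))

fresh-edge : {A : Set} (R : A → A → Set) (ρ : Var → A) (x : Var) (c : A) {a : A} →
             ρ x ≡ a → R ((ρ [ suc x ↦ c ]) x) ((ρ [ suc x ↦ c ]) (suc x)) ⇔ R a c
fresh-edge R ρ x c ρx≡a =
  respects₂ R (trans (update-other ρ c (1+n≢n ∘ sym)) ρx≡a) (update-same ρ (suc x) c)

-- Kripke forcing for modal intuitionistic formulas, read off from ST22.
_,_⊩_ : (M : Model) → U M → MFm → Set
M , a ⊩ var n    = Pm M n a
M , a ⊩ ⊥M       = ⊥
M , a ⊩ (I ∧M J) = (M , a ⊩ I) × (M , a ⊩ J)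
M , a ⊩ (I ∨M J) = (M , a ⊩ I) ⊎ (M , a ⊩ J)
M , a ⊩ (I ⇒M J) = ∀ c → Rm M a c → M , c ⊩ I → M , c ⊩ J
M , a ⊩ □M I     = ∀ c → Rm M a c → ∀ e → R□m M c e → M , e ⊩ I
M , a ⊩ ◇M I     = ∀ c → Rm M a c → Σ (U M) λ e → R◇m M c e × M , e ⊩ I

st-correct : (M : Model) (I : MFm) (x : Var) (ρ : Var → U M) {a : U M} →
             ρ x ≡ a → Sat M ρ (ST22 I x) ⇔ M , a ⊩ I
st-correct M (var n) x ρ refl = ⇔-id _
st-correct M ⊥M      x ρ _    = ⇔-id _
st-correct M (I ∧M J) x ρ ρx≡a = st-correct M I x ρ ρx≡a ×-⇔ st-correct M J x ρ ρx≡a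
st-correct M (I ∨M J) x ρ ρx≡a = st-correct M I x ρ ρx≡a ⊎-⇔ st-correct M J x ρ ρx≡a
st-correct M (I ⇒M J) x ρ ρx≡a = ∀-⇔ λ c →
  let ρ′ = ρ [ suc x ↦ c ] in
  →-cong-⇔ (fresh-edge (Rm M) ρ x c ρx≡a)
    (→-cong-⇔ (st-correct M I (suc x) ρ′ (update-same ρ (suc x) c))
              (st-correct M J (suc x) ρ′ (update-same ρ (suc x) c)))
st-correct M (□M I) x ρ ρx≡a = ∀-⇔ λ c →
  let ρ′ = ρ [ suc x ↦ c ] in
  →-cong-⇔ (fresh-edge (Rm M) ρ x c ρx≡a) (∀-⇔ λ e →
    →-cong-⇔ (fresh-edge (R□m M) ρ′ (suc x) e (update-same ρ (suc x) c))
             (st-correct M I (suc (suc x)) (ρ′ [ suc (suc x) ↦ e ]) (update-same ρ′ (suc (suc x)) e)))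
st-correct M (◇M I) x ρ ρx≡a = ∀-⇔ λ c →
  let ρ′ = ρ [ suc x ↦ c ] in
  →-cong-⇔ (fresh-edge (Rm M) ρ x c ρx≡a) (∃-⇔ λ e →
    fresh-edge (R◇m M) ρ′ (suc x) e (update-same ρ (suc x) c)
    ×-⇔ st-correct M I (suc (suc x)) (ρ′ [ suc (suc x) ↦ e ]) (update-same ρ′ (suc (suc x)) e))

restrict : (ℕ → Set) → Model → Model
restrict Θ M = record
  { U = U M ; Rm = Rm M ; R□m = R□m M ; R◇m = R◇m M
  ; Pm = λ n a → Θ n × Pm M n a }

restrict-sat : {Θ : ℕ → Set} (φ : Fm) → ContainsSig Θ φ → (M : Model) (ρ : Var → U M) →
               Sat M ρ φ ⇔ Sat (restrict Θ M) ρ φ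
restrict-sat (atR x y)  σ M ρ = ⇔-id _
restrict-sat (atR□ x y) σ M ρ = ⇔-id _
restrict-sat (atR◇ x y) σ M ρ = ⇔-id _
restrict-sat (atP n x)  σ M ρ = mk⇔ (σ n here ,_) proj₂
restrict-sat ⊥F         σ M ρ = ⇔-id _
restrict-sat (φ ∧F ψ) σ M ρ =
  restrict-sat φ (λ n → σ n ∘ ∧ˡ) M ρ ×-⇔ restrict-sat ψ (λ n → σ n ∘ ∧ʳ) M ρ
restrict-sat (φ ∨F ψ) σ M ρ =
  restrict-sat φ (λ n → σ n ∘ ∨ˡ) M ρ ⊎-⇔ restrict-sat ψ (λ n → σ n ∘ ∨ʳ) M ρ
restrict-sat (φ ⇒F ψ) σ M ρ =
  →-cong-⇔ (restrict-sat φ (λ n → σ n ∘ ⇒ˡ) M ρ) (restrict-sat ψ (λ n → σ n ∘ ⇒ʳ) M ρ)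
restrict-sat (∀F v φ) σ M ρ = ∀-⇔ λ a → restrict-sat φ (λ n → σ n ∘ ∀o) M (ρ [ v ↦ a ])
restrict-sat (∃F v φ) σ M ρ = ∃-⇔ λ a → restrict-sat φ (λ n → σ n ∘ ∃o) M (ρ [ v ↦ a ])

Full : ℕ → Set
Full _ = ⊤

-- Restricting both models to Θ turns a Θ-asimulation into one for the
-- full signature, since in the restrictions only letters of Θ hold anywhere.
restrict-clauses : {Θ : ℕ → Set} {M N : Model} {AMN : U M → U N → Set}
  {ANM : U N → U M → Set} {BMN : U M → U N → Set} →
  AsimClauses Θ M N AMN ANM BMN → AsimClauses Full (restrict Θ M) (restrict Θ N) AMN ANM BMN
restrict-clauses clauses = record
  { atoms = λ n _ a b aAb (θ , p) → θ , atoms n θ a b aAb p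
  ; forth = forth ; box = box ; toB = toB ; dia = dia }
  where open AsimClauses clauses

-- Implication needs the
-- backward pair (d, c) of the forth clause, hence both directions.
preserve : (I : MFm) {M N : Model}
  {AMN : U M → U N → Set} {ANM : U N → U M → Set}
  {BMN : U M → U N → Set} {BNM : U N → U M → Set} →
  AsimClauses Full M N AMN ANM BMN → AsimClauses Full N M ANM AMN BNM →
  ∀ {a b} → AMN a b → M , a ⊩ I → N , b ⊩ I
preserve (var n) c₁ c₂ {a} {b} aAb p = AsimClauses.atoms c₁ n _ a b aAb p
preserve ⊥M c₁ c₂ aAb ()
preserve (I ∧M J) c₁ c₂ aAb (p , q) = preserve I c₁ c₂ aAb p , preserve J c₁ c₂ aAb q
preserve (I ∨M J) c₁ c₂ aAb (inj₁ p) = inj₁ (preserve I c₁ c₂ aAb p)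
preserve (I ∨M J) c₁ c₂ aAb (inj₂ q) = inj₂ (preserve J c₁ c₂ aAb q)
preserve (I ⇒M J) c₁ c₂ {a} {b} aAb h d bRd d⊩I =
  let (c , aRc , cAd , dAc) = AsimClauses.forth c₁ a b d aAb bRd
  in preserve J c₁ c₂ cAd (h c aRc (preserve I c₂ c₁ dAc d⊩I))
preserve (□M I) c₁ c₂ {a} {b} aAb h d bRd f dR□f =
  let (c , e , aRc , cR□e , eAf) = AsimClauses.box c₁ a b d f aAb bRd dR□f
  in preserve I c₁ c₂ eAf (h c aRc e cR□e)
preserve (◇M I) c₁ c₂ {a} {b} aAb h d bRd =
  let (c , aRc , cBd) = AsimClauses.toB c₁ a b d aAb bRd
      (e , cR◇e , e⊩I) = h c aRc
      (f , dR◇f , eAf) = AsimClauses.dia c₁ c d e cBd cR◇e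
  in f , dR◇f , preserve I c₁ c₂ eAf e⊩I

defined-by-ST22 : {Θ : ℕ → Set} (φ : Fm) (I : MFm) →
  ContainsSig Θ φ → LogEquiv φ (ST22 I 0) →
  (M : Model) (a : U M) → M , a ⊨x φ ⇔ restrict Θ M , a ⊩ I
defined-by-ST22 {Θ} φ I σ φ≡I M a =
  st-correct (restrict Θ M) I 0 (λ _ → a) refl
    ⇔-∘ (φ≡I (restrict Θ M) (λ _ → a) ⇔-∘ restrict-sat φ σ M (λ _ → a))

corollary2 : (φ : Fm) → OnlyFreeX φ →
    Σ MFm (λ I → LogEquiv φ (ST22 I 0)) → Invariant22 φ
corollary2 φ _ (I , φ≡I) Θ σ M₁ M₂ t u A₁₂ A₂₁ B₁₂ B₂₁ asim a b aAb a⊨φ =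
  from (defined-by-ST22 φ I σ φ≡I M₂ b)
    (preserve I (restrict-clauses (Asim22.dir₁₂ asim)) (restrict-clauses (Asim22.dir₂₁ asim))
      aAb (to (defined-by-ST22 φ I σ φ≡I M₁ a) a⊨φ))
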